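{- Let $(\mathbb{C},P)$ be an elementary existential doctrine with singletons, let $A,Y$ be objects of $\mathbb{C}$, and let $\eta_A:A\to S_A$ be the unique morphism with $\lfloor\sigma_A\rfloor\circ\eta_A=\{\delta_A\}$. For every functional relation $F\in P(Y\times A)$ from $Y$ to $A$ there exists a unique morphism $h:Y\to S_A$ such that $F(y,a)=\delta_{S_A}(h(y),\eta_A(a))$, i.e. $F=(h\times\eta_A)^*\delta_{S_A}$.
   Context: A doctrine is a pair $(\mathbb{C},P)$ with $\mathbb{C}$ a category with finite products and $P:\mathbb{C}^{op}\to\mathbf{ISL}$ a functor into inf-semilattices; write $f^*=P(f)$, $\wedge$ for meets, $\top_A$ for the top of $P(A)$. It is elementary existential if each $f^*$ has a left adjoint $\exists_f$ satisfying Beck–Chevalley for pullbacks and Frobenius reciprocity $\exists_f(\alpha\wedge f^*\beta)=\exists_f\alpha\wedge\beta$. Equality on $A$: $\delta_A=\exists_{\Delta_A}\top_A\in P(A\times A)$. A comprehension of $\alpha\in P(A)$ is a morphism $\lfloor\alpha\rfloor:X\to A$ with $\top_X\le\lfloor\alpha\rfloor^*\alpha$ such that every $f:Y\to A$ with $\top_Y\le f^*\alpha$ factors uniquely as $f=\lfloor\alpha\rfloor\circ h$; a morphism $f:X\to Y$ has an image if $\exists_f\top_X$ has a comprehension. Power objects: for each $X$ an object $\mathbb{P}(X)$ and $\in_X\in P(X\times\mathbb{P}(X))$ such that for each $\gamma\in P(X\times Y)$ there is a unique $\{\gamma\}:Y\to\mathbb{P}(X)$ with $\gamma=(\mathrm{id}_X\times\{\gamma\})^*\in_X$;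 write $a\in_X g(y)$ for $(\mathrm{id}_X\times g)^*\in_X$. A formula $F\in P(Y\times A)$ is a functional relation from $Y$ to $A$ if $F(y,a)\wedge F(y,a')\le\delta_A(a,a')$ and $\exists a{:}A.\,F(y,a)=\top_Y$ (internal-language notation). A morphism $f:A\to B$ is internally injective if $\delta_A=(f\times f)^*\delta_B$. The doctrine has singletons if (i) it has power objects; (ii) for every $A$ the morphism $\{\delta_A\}:A\to\mathbb{P}(A)$ has an image and is internally injective; (iii) for every $g:Y\to\mathbb{P}(A)$, the formula $a\in_A g(y)$, read as a relation from $Y$ to $A$, is functional from $Y$ to $A$ iff $g^*(\exists_{\{\delta_A\}}\top_A)=\top_Y$. Write $\sigma_A=\exists_{\{\delta_A\}}\top_A$ and $\lfloor\sigma_A\rfloor:S_A\to\mathbb{P}(A)$ for its comprehension. -}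

module Defs where

open import Level using (Level; _⊔_) renaming (suc to lsuc)
open import Relation.Binary.PropositionalEquality using (_≡_)
open import Data.Product using (Σ; _×_; _,_)
open import Function.Bundles using (_⇔_)

∃!⟨_⟩ : ∀ {a b} (A : Set a) → (A → Set b) → Set (a ⊔ b)
∃!⟨ A ⟩ Q = Σ A (λ x → Q x × (∀ y → Q y → y ≡ x))

record CartesianCategory (o m : Level) : Set (lsuc (o ⊔ m)) where
  infixr 9 _∘_
  infixr 8 _⊗_
  field
    Ob   : Set o
    Hom  : Ob → Ob → Set m
    id   : ∀ {A} → Hom A A
    _∘_  : ∀ {A B C} → Hom B C → Hom A B → Hom A C
    idˡ  : ∀ {A B} (f : Hom A B) → id ∘ f ≡ f
    idʳ  : ∀ {A B} (f : Hom A B) → f ∘ id ≡ f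
    assoc : ∀ {A B C D} (f : Hom C D) (g : Hom B C) (h : Hom A B) →
            (f ∘ g) ∘ h ≡ f ∘ (g ∘ h)
    𝟙    : Ob
    !    : ∀ {A} → Hom A 𝟙
    !-unique : ∀ {A} (f : Hom A 𝟙) → f ≡ !
    _⊗_  : Ob → Ob → Ob
    π₁   : ∀ {A B} → Hom (A ⊗ B) A
    π₂   : ∀ {A B} → Hom (A ⊗ B) B
    ⟨_,_⟩ : ∀ {X A B} → Hom X A → Hom X B → Hom X (A ⊗ B)
    π₁-β : ∀ {X A B} (f : Hom X A) (g : Hom X B) → π₁ ∘ ⟨ f , g ⟩ ≡ f
    π₂-β : ∀ {X A B} (f : Hom X A) (g : Hom X B) → π₂ ∘ ⟨ f , g ⟩ ≡ g
    ⟨⟩-unique : ∀ {X A B} (f : Hom X A) (g : Hom X B) (h : Hom X (A ⊗ B)) →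
                π₁ ∘ h ≡ f → π₂ ∘ h ≡ g → h ≡ ⟨ f , g ⟩

  _⊗₁_ : ∀ {A B C D} → Hom A C → Hom B D → Hom (A ⊗ B) (C ⊗ D)
  f ⊗₁ g = ⟨ f ∘ π₁ , g ∘ π₂ ⟩

  Δ : ∀ {A} → Hom A (A ⊗ A)
  Δ = ⟨ id , id ⟩

  record IsPullback {A B C Pb : Ob} (f : Hom A B) (g : Hom C B)
                    (p₁ : Hom Pb A) (p₂ : Hom Pb C) : Set (o ⊔ m) where
    field
      commutes  : f ∘ p₁ ≡ g ∘ p₂
      universal : ∀ {Z} (u : Hom Z A) (v : Hom Z C) → f ∘ u ≡ g ∘ v →
                  ∃!⟨ Hom Z Pb ⟩ (λ k → (p₁ ∘ k ≡ u) × (p₂ ∘ k ≡ v))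

-- Doctrines: functors C^op → ISL (inf-semilattices, i.e. posets with
-- finite meets; maps preserve finite meets).

record Doctrine (o m p : Level) : Set (lsuc (o ⊔ m ⊔ p)) where
  infixr 7 _∧_
  infix 4 _≤_
  field
    𝐂 : CartesianCategory o m
  open CartesianCategory 𝐂 public
  field
    P    : Ob → Set p
    _≤_  : ∀ {A} → P A → P A → Set p
    ≤-refl    : ∀ {A} {α : P A} → α ≤ α
    ≤-trans   : ∀ {A} {α β γ : P A} → α ≤ β → β ≤ γ → α ≤ γ
    ≤-antisym : ∀ {A} {α β : P A} → α ≤ β → β ≤ α → α ≡ β
    ⊤    : ∀ {A} → P A
    ⊤-max : ∀ {A} (α : P A) → α ≤ ⊤
    _∧_  : ∀ {A} → P A → P A → P A
    ∧-lb₁ : ∀ {A} (α β : P A) → α ∧ β ≤ α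
    ∧-lb₂ : ∀ {A} (α β : P A) → α ∧ β ≤ β
    ∧-glb : ∀ {A} {α β γ : P A} → γ ≤ α → γ ≤ β → γ ≤ α ∧ β
    _^*_ : ∀ {A B} → Hom A B → P B → P A
    ^*-mono : ∀ {A B} (f : Hom A B) {α β : P B} → α ≤ β → f ^* α ≤ f ^* β
    ^*-⊤ : ∀ {A B} (f : Hom A B) → f ^* ⊤ ≡ ⊤
    ^*-∧ : ∀ {A B} (f : Hom A B) (α β : P B) → f ^* (α ∧ β) ≡ (f ^* α) ∧ (f ^* β)
    ^*-id : ∀ {A} (α : P A) → id ^* α ≡ α
    ^*-∘  : ∀ {A B C} (g : Hom B C) (f : Hom A B) (α : P C) →
            (g ∘ f) ^* α ≡ f ^* (g ^* α)

record ElementaryExistentialDoctrine (o m p : Level) : Set (lsuc (o ⊔ m ⊔ p)) where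
  field
    doctrine : Doctrine o m p
  open Doctrine doctrine public
  field
    ∃_ : ∀ {A B} → Hom A B → P A → P B
    ∃⊣^* : ∀ {A B} (f : Hom A B) (α : P A) (β : P B) →
           (∃_ f α ≤ β) ⇔ (α ≤ f ^* β)
    beck-chevalley : ∀ {A B C Pb} (f : Hom A B) (g : Hom C B)
                     (p₁ : Hom Pb A) (p₂ : Hom Pb C) →
                     IsPullback f g p₁ p₂ →
                     ∀ (α : P A) → g ^* (∃_ f α) ≡ ∃_ p₂ (p₁ ^* α)
    frobenius : ∀ {A B} (f : Hom A B) (α : P A) (β : P B) →
                ∃_ f (α ∧ f ^* β) ≡ (∃_ f α) ∧ β

  δ : ∀ A → P (A ⊗ A)
  δ A = ∃_ Δ (⊤ {A})

  record Comprehension {A : Ob} (α : P A) : Set (o ⊔ m ⊔ p) where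
    field
      Dom : Ob
      ⌊⌋  : Hom Dom A
      ⌊⌋-sat : ⊤ ≤ ⌊⌋ ^* α
      ⌊⌋-universal : ∀ {Y} (f : Hom Y A) → ⊤ ≤ f ^* α →
                     ∃!⟨ Hom Y Dom ⟩ (λ h → ⌊⌋ ∘ h ≡ f)

  HasImage : ∀ {X Y} → Hom X Y → Set (o ⊔ m ⊔ p)
  HasImage {X} f = Comprehension (∃_ f (⊤ {X}))

  InternallyInjective : ∀ {A B} → Hom A B → Set p
  InternallyInjective {A} {B} f = δ A ≡ (f ⊗₁ f) ^* δ B

  -- F ∈ P(Y × A) is a functional relation from Y to A:
  --   F(y,a) ∧ F(y,a') ≤ δ_A(a,a')   in context  y:Y, (a,a'):A×A
  --   ∃a:A. F(y,a) = ⊤_Y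
  record Functional {Y A : Ob} (F : P (Y ⊗ A)) : Set p where
    field
      single-valued :
        (⟨ π₁ , π₁ ∘ π₂ ⟩ ^* F) ∧ (⟨ π₁ , π₂ ∘ π₂ ⟩ ^* F)
          ≤ ⟨ π₁ ∘ π₂ , π₂ ∘ π₂ ⟩ ^* δ A
      total : ∃_ (π₁ {Y} {A}) F ≡ ⊤

  record PowerObjects : Set (o ⊔ m ⊔ p) where
    field
      ℘   : Ob → Ob
      ∈   : ∀ X → P (X ⊗ ℘ X)
      ⟦_⟧ : ∀ {X Y} → P (X ⊗ Y) → Hom Y (℘ X)
      ⟦⟧-prop : ∀ {X Y} (γ : P (X ⊗ Y)) → γ ≡ (id ⊗₁ ⟦ γ ⟧) ^* ∈ X
      ⟦⟧-unique : ∀ {X Y} (γ : P (X ⊗ Y)) (g : Hom Y (℘ X)) →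
                  γ ≡ (id ⊗₁ g) ^* ∈ X → g ≡ ⟦ γ ⟧

    sng : ∀ A → Hom A (℘ A)
    sng A = ⟦ δ A ⟧

    σ : ∀ A → P (℘ A)
    σ A = ∃_ (sng A) (⊤ {A})

  record Singletons : Set (o ⊔ m ⊔ p) where
    field
      power : PowerObjects
    open PowerObjects power public
    field
      sng-image : ∀ A → HasImage (sng A)
      sng-injective : ∀ A → InternallyInjective (sng A)
      -- (iii) for g : Y → ℘A, the formula  a ∈_A g(y)  (as relation from
      --      Y to A, i.e. reindexed along the swap Y×A → A×Y) is
      --      functional iff g^* σ_A = ⊤_Y
      sng-functional : ∀ {Y A} (g : Hom Y (℘ A)) →
        Functional (⟨ π₂ , π₁ ⟩ ^* ((id ⊗₁ g) ^* ∈ A)) ⇔ (g ^* σ A ≡ ⊤)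

    S : Ob → Ob
    S A = Comprehension.Dom (sng-image A)

    ⌊σ⌋ : ∀ A → Hom (S A) (℘ A)
    ⌊σ⌋ A = Comprehension.⌊⌋ (sng-image A)

module Submission where

-- Let m = ⌊σ_A⌋ : S_A → ℘A, so that m ∘ η = {δ_A}.  Since m is the
-- comprehension of the image of {δ_A}, the corestriction η is surjective
-- (∃_η ⊤ = ⊤, by Beck–Chevalley along the pullback of {δ_A} and the mono m),
-- and it is internally injective because {δ_A} is.  Reindexing membership along
-- id × m and comparing it with δ_{S_A}(s, η a) after pulling back along the
-- surjection id × η (surjections make reindexing injective, by Frobenius) gives
--     a ∈ m(s)  =  δ_{S_A}(s, η a).                                   (★)
-- For a functional F, axiom (iii) says that its classifying map
-- g = {F(y,a)} : Y → ℘A satisfies g^*σ_A = ⊤, so g = m ∘ h for a unique h; by (★)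
-- F(y,a) = a ∈ g(y) = δ_{S_A}(h y, η a).  Uniqueness: any such h' classifies F
-- through m by (★), and classifying maps and factorisations through m are unique.

open import Defs
open import Level using (Level; _⊔_)
open import Relation.Binary.PropositionalEquality
  using (_≡_; refl; sym; trans; cong; cong₂; subst; module ≡-Reasoning)
open import Data.Product using (_,_; proj₁; proj₂)
open import Function.Bundles using (Equivalence)

module CartesianFacts {o m : Level} (𝐂 : CartesianCategory o m) where
  open CartesianCategory 𝐂

  ⟨⟩-ext : ∀ {X A B} {u v : Hom X (A ⊗ B)} →
           π₁ ∘ u ≡ π₁ ∘ v → π₂ ∘ u ≡ π₂ ∘ v → u ≡ v
  ⟨⟩-ext {u = u} {v} p q =
    trans (⟨⟩-unique (π₁ ∘ v) (π₂ ∘ v) u p q) (sym (⟨⟩-unique _ _ v refl refl))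

  ⟨π₁,π₂⟩≡id : ∀ {A B} → ⟨ π₁ , π₂ ⟩ ≡ id {A ⊗ B}
  ⟨π₁,π₂⟩≡id = sym (⟨⟩-unique π₁ π₂ id (idʳ π₁) (idʳ π₂))

  ⟨⟩-∘ : ∀ {X Z A B} (f : Hom Z A) (g : Hom Z B) (k : Hom X Z) →
         ⟨ f , g ⟩ ∘ k ≡ ⟨ f ∘ k , g ∘ k ⟩
  ⟨⟩-∘ f g k = ⟨⟩-unique _ _ _
    (trans (sym (assoc _ _ _)) (cong (_∘ k) (π₁-β f g)))
    (trans (sym (assoc _ _ _)) (cong (_∘ k) (π₂-β f g)))

  ⊗₁-∘-⟨⟩ : ∀ {X A B C E} (f : Hom A C) (g : Hom B E) (u : Hom X A) (v : Hom X B) →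
            (f ⊗₁ g) ∘ ⟨ u , v ⟩ ≡ ⟨ f ∘ u , g ∘ v ⟩
  ⊗₁-∘-⟨⟩ f g u v = trans (⟨⟩-∘ _ _ _) (cong₂ ⟨_,_⟩
    (trans (assoc _ _ _) (cong (f ∘_) (π₁-β u v)))
    (trans (assoc _ _ _) (cong (g ∘_) (π₂-β u v))))

  ⊗₁-∘ : ∀ {A B C E F G} (f : Hom C F) (g : Hom E G) (f' : Hom A C) (g' : Hom B E) →
         (f ⊗₁ g) ∘ (f' ⊗₁ g') ≡ (f ∘ f') ⊗₁ (g ∘ g')
  ⊗₁-∘ f g f' g' = trans (⊗₁-∘-⟨⟩ f g _ _)
    (cong₂ ⟨_,_⟩ (sym (assoc _ _ _)) (sym (assoc _ _ _)))

  ⊗₁-split : ∀ {A B C E} (f : Hom A C) (g : Hom B E) →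
             (id ⊗₁ g) ∘ (f ⊗₁ id) ≡ f ⊗₁ g
  ⊗₁-split f g = trans (⊗₁-∘ id g f id) (cong₂ _⊗₁_ (idˡ f) (idʳ g))

  swap : ∀ {A B} → Hom (A ⊗ B) (B ⊗ A)
  swap = ⟨ π₂ , π₁ ⟩

  swap-∘-⟨⟩ : ∀ {X A B} (u : Hom X A) (v : Hom X B) → swap ∘ ⟨ u , v ⟩ ≡ ⟨ v , u ⟩
  swap-∘-⟨⟩ u v = trans (⟨⟩-∘ π₂ π₁ _) (cong₂ ⟨_,_⟩ (π₂-β u v) (π₁-β u v))

  swap-involutive : ∀ {A B} → swap ∘ swap ≡ id {A ⊗ B}
  swap-involutive = trans (swap-∘-⟨⟩ π₂ π₁) ⟨π₁,π₂⟩≡id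

  swap-natural : ∀ {A B C E} (f : Hom A C) (g : Hom B E) →
                 (f ⊗₁ g) ∘ swap ≡ swap ∘ (g ⊗₁ f)
  swap-natural f g = trans (⊗₁-∘-⟨⟩ f g π₂ π₁) (sym (swap-∘-⟨⟩ (g ∘ π₁) (f ∘ π₂)))

  Δ-natural : ∀ {A B} (f : Hom A B) → (f ⊗₁ f) ∘ Δ ≡ Δ ∘ f
  Δ-natural f = trans (⊗₁-∘-⟨⟩ f f id id)
    (trans (cong₂ ⟨_,_⟩ (trans (idʳ f) (sym (idˡ f))) (trans (idʳ f) (sym (idˡ f))))
           (sym (⟨⟩-∘ id id f)))

  swap-Δ : ∀ {A} → swap ∘ Δ ≡ Δ ∘ id {A}
  swap-Δ = trans (swap-∘-⟨⟩ id id) (sym (idʳ Δ))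

  Monic : ∀ {A B} → Hom A B → Set (o ⊔ m)
  Monic {A} m = ∀ {Z} (u v : Hom Z A) → m ∘ u ≡ m ∘ v → u ≡ v

  monic-factor-pullback : ∀ {A B C} {s : Hom A B} {m : Hom C B} {e : Hom A C} →
                          Monic m → m ∘ e ≡ s → IsPullback s m id e
  monic-factor-pullback {m = m} {e} m-monic m∘e≡s = record
    { commutes  = trans (idʳ _) (sym m∘e≡s)
    ; universal = λ u v s∘u≡m∘v →
        u , (idˡ u , m-monic (e ∘ u) v
                       (trans (sym (assoc m e u)) (trans (cong (_∘ u) m∘e≡s) s∘u≡m∘v)))
          , λ k k-commutes → trans (sym (idˡ k)) (proj₁ k-commutes) }

  product-pullback : ∀ {X A B} (f : Hom A B) → IsPullback f (π₂ {X}) π₂ (id ⊗₁ f)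
  product-pullback f = record
    { commutes  = sym (π₂-β _ _)
    ; universal = λ u v f∘u≡π₂∘v →
        ⟨ π₁ ∘ v , u ⟩
        , (π₂-β _ _
          , ⟨⟩-ext (trans (cong (π₁ ∘_) (⊗₁-∘-⟨⟩ id f _ _))
                          (trans (π₁-β _ _) (idˡ _)))
                   (trans (cong (π₂ ∘_) (⊗₁-∘-⟨⟩ id f _ _))
                          (trans (π₂-β _ _) f∘u≡π₂∘v)))
        , λ k k-commutes → ⟨⟩-unique _ _ k
            (trans (cong (_∘ k) (sym π₁∘id⊗f))
                   (trans (assoc π₁ (id ⊗₁ f) k) (cong (π₁ ∘_) (proj₂ k-commutes))))
            (proj₁ k-commutes) }
    where
      π₁∘id⊗f : π₁ ∘ (id ⊗₁ f) ≡ π₁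
      π₁∘id⊗f = trans (π₁-β _ _) (idˡ π₁)

module ExistentialFacts {o m p : Level} (D : ElementaryExistentialDoctrine o m p) where
  open ElementaryExistentialDoctrine D
  open CartesianFacts 𝐂

  ≡⇒≤ : ∀ {X} {α β : P X} → α ≡ β → α ≤ β
  ≡⇒≤ refl = ≤-refl

  ⊤-∧ : ∀ {X} (α : P X) → ⊤ ∧ α ≡ α
  ⊤-∧ α = ≤-antisym (∧-lb₂ _ _) (∧-glb (⊤-max α) ≤-refl)

  ∃-unit : ∀ {X Z} (f : Hom X Z) (α : P X) → α ≤ f ^* (∃_ f α)
  ∃-unit f α = Equivalence.to (∃⊣^* f α (∃_ f α)) ≤-refl

  reindex-∘ : ∀ {X Y Z} {f : Hom X Y} {g : Hom Y Z} {k : Hom X Z} (α : P Z) →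
              g ∘ f ≡ k → f ^* (g ^* α) ≡ k ^* α
  reindex-∘ {f = f} {g} α g∘f≡k = trans (sym (^*-∘ g f α)) (cong (_^* α) g∘f≡k)

  swap-swap^* : ∀ {A B} (α : P (A ⊗ B)) → swap ^* (swap ^* α) ≡ α
  swap-swap^* α = trans (reindex-∘ α swap-involutive) (^*-id α)

  reindex-swap : ∀ {X B C E} (f : Hom X C) (g : Hom B E) (α : P (C ⊗ E)) →
                 (id ⊗₁ f) ^* (swap ^* ((id ⊗₁ g) ^* α)) ≡ swap ^* ((f ⊗₁ g) ^* α)
  reindex-swap f g α = begin
    (id ⊗₁ f) ^* (swap ^* ((id ⊗₁ g) ^* α))   ≡⟨ reindex-∘ _ (sym (swap-natural f id)) ⟩
    ((f ⊗₁ id) ∘ swap) ^* ((id ⊗₁ g) ^* α)    ≡⟨ ^*-∘ (f ⊗₁ id) swap _ ⟩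
    swap ^* ((f ⊗₁ id) ^* ((id ⊗₁ g) ^* α))   ≡⟨ cong (swap ^*_) (reindex-∘ α (⊗₁-split f g)) ⟩
    swap ^* ((f ⊗₁ g) ^* α)                   ∎
    where open ≡-Reasoning

  δ-≤-reindex : ∀ {X Z} (f : Hom X Z) (k : Hom (X ⊗ X) (Z ⊗ Z)) →
                k ∘ Δ ≡ Δ ∘ f → δ X ≤ k ^* δ Z
  δ-≤-reindex {Z = Z} f k k∘Δ≡Δ∘f = Equivalence.from (∃⊣^* Δ ⊤ (k ^* δ Z))
    (≤-trans (≡⇒≤ (sym (^*-⊤ f)))
    (≤-trans (^*-mono f (∃-unit Δ ⊤))
             (≡⇒≤ (trans (sym (^*-∘ Δ f (δ Z)))
                         (sym (reindex-∘ (δ Z) k∘Δ≡Δ∘f))))))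

  δ-preserved : ∀ {X Z} (f : Hom X Z) → δ X ≤ (f ⊗₁ f) ^* δ Z
  δ-preserved f = δ-≤-reindex f (f ⊗₁ f) (Δ-natural f)

  δ-symmetric : ∀ {X} → swap ^* δ X ≡ δ X
  δ-symmetric {X} = ≤-antisym
    (≤-trans (^*-mono swap δ≤swap^*δ) (≡⇒≤ (swap-swap^* (δ X))))
    δ≤swap^*δ
    where
      δ≤swap^*δ : δ X ≤ swap ^* δ X
      δ≤swap^*δ = δ-≤-reindex id swap swap-Δ

  injective-left-factor : ∀ {A B C} {s : Hom A B} {m : Hom C B} {e : Hom A C} →
                          InternallyInjective s → m ∘ e ≡ s → InternallyInjective e
  injective-left-factor {m = m} {e} s-injective m∘e≡s = ≤-antisym
    (δ-preserved e)
    (≤-trans (^*-mono (e ⊗₁ e) (δ-preserved m))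
             (≡⇒≤ (trans (reindex-∘ (δ _) (trans (⊗₁-∘ m m e e) (cong₂ _⊗₁_ m∘e≡s m∘e≡s)))
                         (sym s-injective))))

  -- f is (internally) surjective when ∀z ∃x. f x = z, i.e. ∃_f ⊤ = ⊤.
  Surjective : ∀ {X Z} → Hom X Z → Set p
  Surjective f = ∃_ f ⊤ ≡ ⊤

  -- Reindexing along a surjection is injective (by Frobenius reciprocity).
  surjective-cancel : ∀ {X Z} {f : Hom X Z} → Surjective f →
                      {α β : P Z} → f ^* α ≡ f ^* β → α ≡ β
  surjective-cancel {f = f} f-surjective {α} {β} f^*α≡f^*β = begin
    α                  ≡⟨ sym (⊤-∧ α) ⟩
    ⊤ ∧ α              ≡⟨ cong (_∧ α) (sym f-surjective) ⟩
    ∃_ f ⊤ ∧ α         ≡⟨ sym (frobenius f ⊤ α) ⟩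
    ∃_ f (⊤ ∧ f ^* α)  ≡⟨ cong (λ γ → ∃_ f (⊤ ∧ γ)) f^*α≡f^*β ⟩
    ∃_ f (⊤ ∧ f ^* β)  ≡⟨ frobenius f ⊤ β ⟩
    ∃_ f ⊤ ∧ β         ≡⟨ cong (_∧ β) f-surjective ⟩
    ⊤ ∧ β              ≡⟨ ⊤-∧ β ⟩
    β                  ∎
    where open ≡-Reasoning

  ∃⊤-pullback : ∀ {A B C Pb} {f : Hom A B} {g : Hom C B}
                {p₁ : Hom Pb A} {p₂ : Hom Pb C} →
                IsPullback f g p₁ p₂ → ∃_ p₂ ⊤ ≡ g ^* (∃_ f ⊤)
  ∃⊤-pullback {f = f} {g} {p₁} {p₂} pb =
    trans (cong (∃_ p₂) (sym (^*-⊤ p₁))) (sym (beck-chevalley f g p₁ p₂ pb ⊤))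

  surjective-pullback : ∀ {A B C Pb} {f : Hom A B} {g : Hom C B}
                        {p₁ : Hom Pb A} {p₂ : Hom Pb C} →
                        IsPullback f g p₁ p₂ → Surjective f → Surjective p₂
  surjective-pullback {g = g} pb f-surjective =
    trans (∃⊤-pullback pb) (trans (cong (g ^*_) f-surjective) (^*-⊤ g))

  comprehension-monic : ∀ {A} {α : P A} (C : Comprehension α) → Monic (Comprehension.⌊⌋ C)
  comprehension-monic {α = α} C u v ⌊⌋∘u≡⌊⌋∘v =
    trans (unique u ⌊⌋∘u≡⌊⌋∘v) (sym (unique v refl))
    where
      open Comprehension C
      ⌊⌋∘v-sat : ⊤ ≤ (⌊⌋ ∘ v) ^* α
      ⌊⌋∘v-sat = ≤-trans (≡⇒≤ (sym (^*-⊤ v)))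
                 (≤-trans (^*-mono v ⌊⌋-sat) (≡⇒≤ (sym (^*-∘ ⌊⌋ v α))))
      unique : ∀ k → ⌊⌋ ∘ k ≡ ⌊⌋ ∘ v → k ≡ proj₁ (⌊⌋-universal (⌊⌋ ∘ v) ⌊⌋∘v-sat)
      unique = proj₂ (proj₂ (⌊⌋-universal (⌊⌋ ∘ v) ⌊⌋∘v-sat))

  corestriction-surjective : ∀ {A B} {s : Hom A B} (C : HasImage s)
                             (e : Hom A (Comprehension.Dom C)) →
                             Comprehension.⌊⌋ C ∘ e ≡ s → Surjective e
  corestriction-surjective {s = s} C e ⌊⌋∘e≡s =
    trans (∃⊤-pullback pb) (≤-antisym (⊤-max _) (Comprehension.⌊⌋-sat C))
    where
      pb : IsPullback s (Comprehension.⌊⌋ C) id e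
      pb = monic-factor-pullback (comprehension-monic C) ⌊⌋∘e≡s

module SingletonFacts {o m p : Level} (D : ElementaryExistentialDoctrine o m p)
                      (sg : ElementaryExistentialDoctrine.Singletons D) where
  open ElementaryExistentialDoctrine D
  open Singletons sg
  open CartesianFacts 𝐂
  open ExistentialFacts D

  classifier-recovers : ∀ {Y A} (F : P (Y ⊗ A)) →
                        swap ^* ((id ⊗₁ ⟦ swap ^* F ⟧) ^* ∈ A) ≡ F
  classifier-recovers F =
    trans (cong (swap ^*_) (sym (⟦⟧-prop (swap ^* F)))) (swap-swap^* F)

  functional-in-σ : ∀ {Y A} (F : P (Y ⊗ A)) → Functional F → ⟦ swap ^* F ⟧ ^* σ A ≡ ⊤
  functional-in-σ F F-functional = Equivalence.to (sng-functional ⟦ swap ^* F ⟧)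
    (subst Functional (sym (classifier-recovers F)) F-functional)

  module _ (A : Ob) (η : Hom A (S A)) (⌊σ⌋∘η≡sng : ⌊σ⌋ A ∘ η ≡ sng A) where

    -- η is the corestriction of {δ_A} to its image, hence surjective, and it
    -- inherits internal injectivity from {δ_A}.
    η-surjective : Surjective η
    η-surjective = corestriction-surjective (sng-image A) η ⌊σ⌋∘η≡sng

    η-injective : InternallyInjective η
    η-injective = injective-left-factor (sng-injective A) ⌊σ⌋∘η≡sng

    -- (★): for s : S_A,  a ∈ ⌊σ_A⌋(s)  ⇔  s = η(a).  Both sides agree after
    -- reindexing along the surjection id × η, where they become δ_A.
    membership-in-singleton :
      (id ⊗₁ ⌊σ⌋ A) ^* ∈ A ≡ swap ^* ((id ⊗₁ η) ^* δ (S A))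
    membership-in-singleton = surjective-cancel id⊗η-surjective (begin
      (id ⊗₁ η) ^* ((id ⊗₁ ⌊σ⌋ A) ^* ∈ A)  ≡⟨ reindex-∘ (∈ A) id⊗⌊σ⌋∘η ⟩
      (id ⊗₁ sng A) ^* ∈ A                 ≡⟨ sym (⟦⟧-prop (δ A)) ⟩
      δ A                                  ≡⟨ sym δ-symmetric ⟩
      swap ^* δ A                          ≡⟨ cong (swap ^*_) η-injective ⟩
      swap ^* ((η ⊗₁ η) ^* δ (S A))        ≡⟨ sym (reindex-swap η η (δ (S A))) ⟩
      (id ⊗₁ η) ^* (swap ^* ((id ⊗₁ η) ^* δ (S A)))  ∎)
      where
        open ≡-Reasoning
        id⊗η-surjective : Surjective (id {A} ⊗₁ η)
        id⊗η-surjective = surjective-pullback (product-pullback η) η-surjective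
        id⊗⌊σ⌋∘η : (id ⊗₁ ⌊σ⌋ A) ∘ (id ⊗₁ η) ≡ id ⊗₁ sng A
        id⊗⌊σ⌋∘η = trans (⊗₁-∘ id (⌊σ⌋ A) id η) (cong₂ _⊗₁_ (idˡ id) ⌊σ⌋∘η≡sng)

    classified-relation : ∀ {Y} (h : Hom Y (S A)) →
      (id ⊗₁ (⌊σ⌋ A ∘ h)) ^* ∈ A ≡ swap ^* ((h ⊗₁ η) ^* δ (S A))
    classified-relation h = begin
      (id ⊗₁ (⌊σ⌋ A ∘ h)) ^* ∈ A                    ≡⟨ sym (reindex-∘ (∈ A) id⊗⌊σ⌋∘h) ⟩
      (id ⊗₁ h) ^* ((id ⊗₁ ⌊σ⌋ A) ^* ∈ A)           ≡⟨ cong ((id ⊗₁ h) ^*_) membership-in-singleton ⟩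
      (id ⊗₁ h) ^* (swap ^* ((id ⊗₁ η) ^* δ (S A)))  ≡⟨ reindex-swap h η (δ (S A)) ⟩
      swap ^* ((h ⊗₁ η) ^* δ (S A))                 ∎
      where
        open ≡-Reasoning
        id⊗⌊σ⌋∘h : (id ⊗₁ ⌊σ⌋ A) ∘ (id ⊗₁ h) ≡ id ⊗₁ (⌊σ⌋ A ∘ h)
        id⊗⌊σ⌋∘h = trans (⊗₁-∘ id (⌊σ⌋ A) id h) (cong (_⊗₁ (⌊σ⌋ A ∘ h)) (idˡ id))

lemma4p5 : ∀ {o m p : Level} (D : ElementaryExistentialDoctrine o m p) →
    let open ElementaryExistentialDoctrine D in
    (sg : Singletons) →
    let open Singletons sg in
    (A Y : Ob) (η : Hom A (S A)) → ⌊σ⌋ A ∘ η ≡ sng A →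
    (F : P (Y ⊗ A)) → Functional F →
    ∃!⟨ Hom Y (S A) ⟩ (λ h → F ≡ (h ⊗₁ η) ^* δ (S A))
lemma4p5 D sg A Y η ⌊σ⌋∘η≡sng F F-functional = h , F≡δ[h,η] , unique
  where
    open ElementaryExistentialDoctrine D
    open Singletons sg
    open CartesianFacts 𝐂
    open ExistentialFacts D
    open SingletonFacts D sg

    -- The classifying map g of F lies in σ_A, hence factors as ⌊σ_A⌋ ∘ h.
    g : Hom Y (℘ A)
    g = ⟦ swap ^* F ⟧
    factorisation : ∃!⟨ Hom Y (S A) ⟩ (λ k → ⌊σ⌋ A ∘ k ≡ g)
    factorisation = Comprehension.⌊⌋-universal (sng-image A) g
                      (≡⇒≤ (sym (functional-in-σ F F-functional)))
    h : Hom Y (S A)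
    h = proj₁ factorisation

    ⌊σ⌋∘h≡g : ⌊σ⌋ A ∘ h ≡ g
    ⌊σ⌋∘h≡g = proj₁ (proj₂ factorisation)

    classified : ∀ h' → (id ⊗₁ (⌊σ⌋ A ∘ h')) ^* ∈ A ≡ swap ^* ((h' ⊗₁ η) ^* δ (S A))
    classified = classified-relation A η ⌊σ⌋∘η≡sng

    F≡δ[h,η] : F ≡ (h ⊗₁ η) ^* δ (S A)
    F≡δ[h,η] = begin
      F                                            ≡⟨ sym (classifier-recovers F) ⟩
      swap ^* ((id ⊗₁ g) ^* ∈ A)                   ≡⟨ cong (λ k → swap ^* ((id ⊗₁ k) ^* ∈ A)) (sym ⌊σ⌋∘h≡g) ⟩
      swap ^* ((id ⊗₁ (⌊σ⌋ A ∘ h)) ^* ∈ A)         ≡⟨ cong (swap ^*_) (classified h) ⟩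
      swap ^* (swap ^* ((h ⊗₁ η) ^* δ (S A)))      ≡⟨ swap-swap^* _ ⟩
      (h ⊗₁ η) ^* δ (S A)                          ∎
      where open ≡-Reasoning

    -- Any h' representing F also classifies F through ⌊σ_A⌋, so h' = h.
    unique : ∀ h' → F ≡ (h' ⊗₁ η) ^* δ (S A) → h' ≡ h
    unique h' F≡δ[h',η] = proj₂ (proj₂ factorisation) h'
      (⟦⟧-unique (swap ^* F) (⌊σ⌋ A ∘ h')
        (trans (cong (swap ^*_) F≡δ[h',η]) (sym (classified h'))))
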